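{- For any string $X$, we have $|\mathsf{LZ}(X)|\le 2\cdot\mathrm{selfed}(X)$.
   Context: An alignment of $X$ onto $Y$ is a sequence $(x_t,y_t)_{t=0}^{\ell}$ from $(0,0)$ to $(|X|,|Y|)$ with steps $(+1,+1)$ (aligns $X[x_t]$ with $Y[y_t]$; a match if equal, a substitution otherwise), $(+1,0)$ (deletes $X[x_t]$), $(0,+1)$ (inserts $Y[y_t]$); its cost is the number of insertions, deletions and substitutions. A self-alignment of $X$ is an alignment of $X$ onto $X$ that does not align any character $X[x]$ with itself; the self-edit distance $\mathrm{selfed}(X)$ is the minimum cost of a self-alignment of $X$. $\mathsf{LZ}(X)$ denotes the LZ77 factorization of $X$: the greedy left-to-right parsing of $X$ into phrases, where each phrase starting at position $i$ is the longest fragment $X[i..i+\ell)$ that has an earlier occurrence $X[i'..i'+\ell)$ with $i'<i$, or the single character $X[i]$ if no such nonempty fragment exists; $|\mathsf{LZ}(X)|$ is the number of phrases (which is the minimum size of any such factorization in which each phrase of length greater than one has an earlier occurrence). -}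

module Defs where

open import Data.Nat using (ℕ; zero; suc; _+_; _≤_; _<_)
open import Data.List using (List; []; _∷_; length)
open import Data.Maybe using (Maybe; just; nothing)
open import Data.Product using (_×_; _,_; ∃-syntax; Σ-syntax)
open import Data.Sum using (_⊎_)
open import Data.Unit using (⊤)
open import Relation.Nullary using (¬_; yes; no)
open import Relation.Binary.PropositionalEquality using (_≡_; _≢_)
open import Relation.Binary.Definitions using (DecidableEquality)

_!?_ : {A : Set} → List A → ℕ → Maybe A
[]       !? _       = nothing
(a ∷ _)  !? zero    = just a
(_ ∷ xs) !? (suc i) = xs !? i

data Step : Set where
  diag del ins : Step

endpoint : ℕ → ℕ → List Step → ℕ × ℕ
endpoint x y []           = x , y
endpoint x y (diag ∷ ss)  = endpoint (suc x) (suc y) ss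
endpoint x y (del ∷ ss)   = endpoint (suc x) y ss
endpoint x y (ins ∷ ss)   = endpoint x (suc y) ss

IsAlignment : {A : Set} → List A → List A → List Step → Set
IsAlignment X Y ss = endpoint 0 0 ss ≡ (length X , length Y)

module _ {A : Set} (_≟_ : DecidableEquality A) where

  costFrom : List A → List A → ℕ → ℕ → List Step → ℕ
  costFrom X Y x y []          = 0
  costFrom X Y x y (del ∷ ss)  = suc (costFrom X Y (suc x) y ss)
  costFrom X Y x y (ins ∷ ss)  = suc (costFrom X Y x (suc y) ss)
  costFrom X Y x y (diag ∷ ss) = sub (X !? x) (Y !? y) + costFrom X Y (suc x) (suc y) ss
    where
    sub : Maybe A → Maybe A → ℕ
    sub (just a) (just b) with a ≟ b
    ... | yes _ = 0
    ... | no  _ = 1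
    sub _ _ = 1   -- unreachable for valid alignments

  cost : List A → List A → List Step → ℕ
  cost X Y ss = costFrom X Y 0 0 ss

NoSelfMatchFrom : ℕ → ℕ → List Step → Set
NoSelfMatchFrom x y []          = ⊤
NoSelfMatchFrom x y (diag ∷ ss) = (x ≢ y) × NoSelfMatchFrom (suc x) (suc y) ss
NoSelfMatchFrom x y (del ∷ ss)  = NoSelfMatchFrom (suc x) y ss
NoSelfMatchFrom x y (ins ∷ ss)  = NoSelfMatchFrom x (suc y) ss

IsSelfAlignment : {A : Set} → List A → List Step → Set
IsSelfAlignment X ss = IsAlignment X X ss × NoSelfMatchFrom 0 0 ss

SelfEd : {A : Set} → DecidableEquality A → List A → ℕ → Set
SelfEd _≟_ X k =
  (∃[ ss ] (IsSelfAlignment X ss × cost _≟_ X X ss ≡ k)) ×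
  (∀ ss → IsSelfAlignment X ss → k ≤ cost _≟_ X X ss)

-- X[i..i+ℓ) is a fragment of X with an earlier occurrence X[i'..i'+ℓ), i' < i
-- (occurrences may overlap).
HasEarlierOcc : {A : Set} → List A → ℕ → ℕ → Set
HasEarlierOcc X i ℓ =
  (i + ℓ ≤ length X) ×
  (∃[ i' ] ((i' < i) × (∀ j → j < ℓ → X !? (i' + j) ≡ X !? (i + j))))

LZPhrase : {A : Set} → List A → ℕ → ℕ → Set
LZPhrase X i ℓ =
  (1 ≤ ℓ × HasEarlierOcc X i ℓ × (∀ ℓ' → HasEarlierOcc X i ℓ' → ℓ' ≤ ℓ))
  ⊎ (ℓ ≡ 1 × ¬ HasEarlierOcc X i 1)

data LZFrom {A : Set} (X : List A) : ℕ → List ℕ → Set where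
  done : LZFrom X (length X) []
  next : ∀ {i ℓ ℓs} → i < length X → LZPhrase X i ℓ →
         LZFrom X (i + ℓ) ℓs → LZFrom X i (ℓ ∷ ℓs)

-- LZ X ℓs : ℓs is the LZ77 factorization of X (as phrase lengths);
-- |LZ(X)| = length ℓs.
LZ : {A : Set} → List A → List ℕ → Set
LZ X ℓs = LZFrom X 0 ℓs

{-# OPTIONS --safe #-}
module Submission where

-- Reflecting across the diagonal the parts of a self-alignment of cost k that lie below it
-- yields an alignment of X onto itself of the same cost whose matches (x , y) all have x < y.
-- Read along the second copy of X, each maximal run of its matches is a fragment with an
-- earlier occurrence and is followed by an edit, and every inserted or substituted character
-- is a phrase of its own; this factorizes X into at most 2k phrases, and the greedy LZ77
-- parsing is no longer than any factorization whose long phrases have earlier occurrences.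

open import Defs
open import Data.Nat using (ℕ; zero; suc; _+_; _*_; _≤_; _<_; _⊓_; _⊔_; z≤n; s≤s; _≤?_; _<?_)
open import Data.Nat.Properties
open import Data.List using (List; []; _∷_; length)
open import Data.Maybe using (just; nothing)
open import Data.Product using (_×_; _,_; proj₁; proj₂; ∃-syntax)
open import Data.Sum using (_⊎_; inj₁; inj₂)
open import Data.Empty using (⊥-elim)
open import Relation.Nullary using (yes; no)
open import Relation.Binary.PropositionalEquality
open import Relation.Binary.Definitions using (DecidableEquality)

module _ {A : Set} (X : List A) where

  SameChar : ℕ → ℕ → Set
  SameChar a b = X !? a ≡ X !? b

  Copies : ℕ → ℕ → ℕ → Set
  Copies u v r = ∀ j → j < r → SameChar (u + j) (v + j)

  copies-cons : ∀ {u v r} → SameChar u v → Copies (suc u) (suc v) r → Copies u v (suc r)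
  copies-cons {u} {v} u≈v _ zero _ =
    subst₂ SameChar (sym (+-identityʳ u)) (sym (+-identityʳ v)) u≈v
  copies-cons {u} {v} _ copy (suc j) (s≤s j<r) =
    subst₂ SameChar (sym (+-suc u j)) (sym (+-suc v j)) (copy j j<r)

  copies-drop : ∀ {u v} d {r} → Copies u v (d + r) → Copies (u + d) (v + d) r
  copies-drop {u} {v} d copy j j<r =
    subst₂ SameChar (sym (+-assoc u d j)) (sym (+-assoc v d j)) (copy (d + j) (+-monoʳ-< d j<r))

  earlierOcc-prefix : ∀ {i ℓ ℓ′} → ℓ′ ≤ ℓ → HasEarlierOcc X i ℓ → HasEarlierOcc X i ℓ′
  earlierOcc-prefix {i} ℓ′≤ℓ (bound , i′ , i′<i , copy) =
    ≤-trans (+-monoʳ-≤ i ℓ′≤ℓ) bound , i′ , i′<i , λ j j<ℓ′ → copy j (≤-trans j<ℓ′ ℓ′≤ℓ)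

  earlierOcc-suffix : ∀ {i} d ℓ → HasEarlierOcc X i (d + ℓ) → HasEarlierOcc X (i + d) ℓ
  earlierOcc-suffix {i} d ℓ (bound , i′ , i′<i , copy) =
    subst (_≤ length X) (sym (+-assoc i d ℓ)) bound , i′ + d , +-monoˡ-< d i′<i , copies-drop d copy

  ValidPhrase : ℕ → ℕ → Set
  ValidPhrase i ℓ = ℓ ≡ 1 ⊎ (1 ≤ ℓ × HasEarlierOcc X i ℓ)

  data Factorization : ℕ → ℕ → Set where
    done : Factorization (length X) 0
    next : ∀ {i ℓ m} → ValidPhrase i ℓ → Factorization (i + ℓ) m → Factorization i (suc m)

  factorization-bounded : ∀ {i m} → Factorization i m → i ≤ length X
  factorization-bounded done = ≤-refl
  factorization-bounded {i} (next {ℓ = ℓ} _ f) = ≤-trans (m≤m+n i ℓ) (factorization-bounded f)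

  factorization-single : ∀ {i m} → Factorization (suc i) m → Factorization i (suc m)
  factorization-single {i} {m} f =
    next (inj₁ refl) (subst (λ j → Factorization j m) (sym (+-comm i 1)) f)

  lzPhrase-nonempty : ∀ {p ℓ} → LZPhrase X p ℓ → 1 ≤ ℓ
  lzPhrase-nonempty (inj₁ (1≤ℓ , _)) = 1≤ℓ
  lzPhrase-nonempty (inj₂ (refl , _)) = s≤s z≤n

  lzPhrase-maximal : ∀ {p ℓ ℓ′} → LZPhrase X p ℓ → 1 ≤ ℓ′ → HasEarlierOcc X p ℓ′ → ℓ′ ≤ ℓ
  lzPhrase-maximal (inj₁ (_ , _ , longest)) _ occ = longest _ occ
  lzPhrase-maximal (inj₂ (_ , noOcc)) 1≤ℓ′ occ = ⊥-elim (noOcc (earlierOcc-prefix 1≤ℓ′ occ))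

  -- The tail of a valid phrase from p on has an earlier occurrence, so the LZ77 phrase at p
  -- is at least as long.
  lzPhrase-reaches : ∀ {i L p ℓ} → ValidPhrase i L → i ≤ p → p < i + L → LZPhrase X p ℓ →
                     i + L ≤ p + ℓ
  lzPhrase-reaches (inj₁ refl) i≤p _ lz = +-mono-≤ i≤p (lzPhrase-nonempty lz)
  lzPhrase-reaches {i} {L} {ℓ = ℓ} (inj₂ (_ , occ)) i≤p p<i+L lz
    with m≤n⇒∃[o]m+o≡n i≤p
  ... | d , refl with m≤n⇒∃[o]m+o≡n (+-cancelˡ-< i d L p<i+L)
  ... | e , refl = begin
    i + (suc d + e)  ≡⟨ cong (i +_) (+-suc d e) ⟨
    i + (d + suc e)  ≡⟨ +-assoc i d (suc e) ⟨
    i + d + suc e    ≤⟨ +-monoʳ-≤ (i + d) (lzPhrase-maximal lz (s≤s z≤n) tailOcc) ⟩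
    i + d + ℓ        ∎
    where
    open ≤-Reasoning
    tailOcc : HasEarlierOcc X (i + d) (suc e)
    tailOcc = earlierOcc-suffix d (suc e) (subst (HasEarlierOcc X i) (sym (+-suc d e)) occ)

  lz-optimal : ∀ {p ℓs i m} → LZFrom X p ℓs → Factorization i m → i ≤ p → length ℓs ≤ m
  lz-optimal done _ _ = z≤n
  lz-optimal (next p<n _ _) done n≤p = ⊥-elim (<⇒≱ p<n n≤p)
  lz-optimal lz@(next _ lzPhrase rest) (next {i} {L} valid f) i≤p with i + L ≤? _
  ... | yes i+L≤p = m≤n⇒m≤1+n (lz-optimal lz f i+L≤p)
  ... | no i+L≰p  = s≤s (lz-optimal rest f (lzPhrase-reaches valid i≤p (≰⇒> i+L≰p) lzPhrase))

  -- Walk u v c: an alignment of X onto itself from (u , v) to the end, of cost c, whose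
  -- matches all lie strictly above the diagonal.
  data Walk : ℕ → ℕ → ℕ → Set where
    stop       : Walk (length X) (length X) 0
    match      : ∀ {u v c} → u < v → SameChar u v → Walk (suc u) (suc v) c → Walk u v c
    insert     : ∀ {u v c} → Walk u (suc v) c → Walk u v (suc c)
    substitute : ∀ {u v c} → Walk (suc u) (suc v) c → Walk u v (suc c)
    delete     : ∀ {u v c} → u < v → Walk (suc u) v c → Walk u v (suc c)

  CopyPrefixed : ℕ → ℕ → ℕ → Set
  CopyPrefixed u v m = ∃[ r ] (Copies u v r × Factorization (v + r) m)

  copyPrefixed-extend : ∀ {u v m} → SameChar u v → CopyPrefixed (suc u) (suc v) m →
                        CopyPrefixed u v m
  copyPrefixed-extend {v = v} {m} u≈v (r , copy , f) =
    suc r , copies-cons u≈v copy , subst (λ i → Factorization i m) (sym (+-suc v r)) f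

  copyPrefixed-close : ∀ {u v m} → u < v → CopyPrefixed u v m →
                       ∃[ m′ ] (Factorization v m′ × m′ ≤ suc m)
  copyPrefixed-close {v = v} {m} _ (zero , _ , f) =
    m , subst (λ i → Factorization i m) (+-identityʳ v) f , n≤1+n m
  copyPrefixed-close {u} {m = m} u<v (suc r , copy , f) =
    suc m , next (inj₂ (s≤s z≤n , factorization-bounded f , u , u<v , copy)) f , ≤-refl

  -- The second component accounts for a run of matches from (u , v) that is still open:
  -- it is closed into a single copied phrase once the run ends.
  Factorizable : ℕ → ℕ → ℕ → Set
  Factorizable u v c = (∃[ m ] (Factorization v m × m ≤ 2 * c))
                     × (u < v → ∃[ m ] (CopyPrefixed u v m × suc m ≤ 2 * c))

  factorizable-edit : ∀ {u v m c} → Factorization v m → m ≤ suc (2 * c) → Factorizable u v (suc c)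
  factorizable-edit {v = v} {m} {c} f m≤ =
    (m , f , ≤-trans (n≤1+n m) 1+m≤) ,
    λ _ → m , (0 , (λ _ ()) , subst (λ i → Factorization i m) (sym (+-identityʳ v)) f) , 1+m≤
    where
    1+m≤ : suc m ≤ 2 * suc c
    1+m≤ = subst (suc m ≤_) (sym (*-suc 2 c)) (s≤s m≤)

  walk⇒factorizable : ∀ {u v c} → Walk u v c → Factorizable u v c
  walk⇒factorizable stop = (0 , done , z≤n) , λ n<n → ⊥-elim (<-irrefl refl n<n)
  walk⇒factorizable (match u<v u≈v w) =
    let m , run , 1+m≤ = proj₂ (walk⇒factorizable w) (s≤s u<v)
        run′           = copyPrefixed-extend u≈v run
        m′ , f , m′≤   = copyPrefixed-close u<v run′
    in  (m′ , f , ≤-trans m′≤ 1+m≤) , λ _ → m , run′ , 1+m≤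
  walk⇒factorizable (insert w) =
    let m , f , m≤ = proj₁ (walk⇒factorizable w)
    in  factorizable-edit (factorization-single f) (s≤s m≤)
  walk⇒factorizable (substitute w) =
    let m , f , m≤ = proj₁ (walk⇒factorizable w)
    in  factorizable-edit (factorization-single f) (s≤s m≤)
  walk⇒factorizable (delete _ w) =
    let m , f , m≤ = proj₁ (walk⇒factorizable w)
    in  factorizable-edit f (m≤n⇒m≤1+n m≤)

  SortedWalk : ℕ → ℕ → ℕ → Set
  SortedWalk x y c = Walk (x ⊓ y) (x ⊔ y) c

  sortedWalk-comm : ∀ {x y c} → SortedWalk x y c → SortedWalk y x c
  sortedWalk-comm {x} {y} {c} = subst₂ (λ u v → Walk u v c) (⊓-comm x y) (⊔-comm x y)

  -- Advancing the smaller coordinate is a deletion, advancing the larger one an insertion.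
  sortedWalk-advance : ∀ x y {c} → SortedWalk (suc x) y c → SortedWalk x y (suc c)
  sortedWalk-advance x y w with x <? y
  ... | yes x<y rewrite m≤n⇒m⊓n≡m x<y | m≤n⇒m⊔n≡n x<y
                      | m≤n⇒m⊓n≡m (<⇒≤ x<y) | m≤n⇒m⊔n≡n (<⇒≤ x<y) = delete x<y w
  ... | no x≮y  rewrite m≥n⇒m⊓n≡n (m≤n⇒m≤1+n (≮⇒≥ x≮y)) | m≥n⇒m⊔n≡m (m≤n⇒m≤1+n (≮⇒≥ x≮y))
                      | m≥n⇒m⊓n≡n (≮⇒≥ x≮y) | m≥n⇒m⊔n≡m (≮⇒≥ x≮y) = insert w

  ⊓<⊔ : ∀ {x y} → x ≢ y → x ⊓ y < x ⊔ y
  ⊓<⊔ {x} {y} x≢y with ≤-total x y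
  ... | inj₁ x≤y rewrite m≤n⇒m⊓n≡m x≤y | m≤n⇒m⊔n≡n x≤y = ≤∧≢⇒< x≤y x≢y
  ... | inj₂ y≤x rewrite m≥n⇒m⊓n≡n y≤x | m≥n⇒m⊔n≡m y≤x = ≤∧≢⇒< y≤x (λ y≡x → x≢y (sym y≡x))

  sameChar-sorted : ∀ {x y} → SameChar x y → SameChar (x ⊓ y) (x ⊔ y)
  sameChar-sorted {x} {y} x≈y with ≤-total x y
  ... | inj₁ x≤y rewrite m≤n⇒m⊓n≡m x≤y | m≤n⇒m⊔n≡n x≤y = x≈y
  ... | inj₂ y≤x rewrite m≥n⇒m⊓n≡n y≤x | m≥n⇒m⊔n≡m y≤x = sym x≈y

  module _ (_≟_ : DecidableEquality A) where

    private
      C : ℕ → ℕ → List Step → ℕ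
      C = costFrom _≟_ X X

    sortedWalk-diag : ∀ {x y} ss → x ≢ y → SortedWalk (suc x) (suc y) (C (suc x) (suc y) ss) →
                      SortedWalk x y (C x y (diag ∷ ss))
    sortedWalk-diag {x} {y} ss x≢y w with X !? x in eqx | X !? y in eqy
    ... | just a | just b with a ≟ b
    ...   | yes refl = match (⊓<⊔ x≢y) (sameChar-sorted (trans eqx (sym eqy))) w
    ...   | no _     = substitute w
    sortedWalk-diag ss x≢y w | just _  | nothing = substitute w
    sortedWalk-diag ss x≢y w | nothing | _       = substitute w

    selfAlignment⇒sortedWalk : ∀ x y ss → NoSelfMatchFrom x y ss →
                               endpoint x y ss ≡ (length X , length X) →
                               SortedWalk x y (C x y ss)
    selfAlignment⇒sortedWalk x y [] _ refl =
      subst₂ (λ u v → Walk u v 0) (sym (⊓-idem (length X))) (sym (⊔-idem (length X))) stop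
    selfAlignment⇒sortedWalk x y (diag ∷ ss) (x≢y , noSelfMatch) end =
      sortedWalk-diag ss x≢y (selfAlignment⇒sortedWalk (suc x) (suc y) ss noSelfMatch end)
    selfAlignment⇒sortedWalk x y (del ∷ ss) noSelfMatch end =
      sortedWalk-advance x y (selfAlignment⇒sortedWalk (suc x) y ss noSelfMatch end)
    selfAlignment⇒sortedWalk x y (ins ∷ ss) noSelfMatch end =
      sortedWalk-comm (sortedWalk-advance y x
        (sortedWalk-comm (selfAlignment⇒sortedWalk x (suc y) ss noSelfMatch end)))

lemma3p7 : {A : Set} (_≟_ : DecidableEquality A) (X : List A) (k : ℕ) (ℓs : List ℕ) →
    SelfEd _≟_ X k → LZ X ℓs → length ℓs ≤ 2 * k
lemma3p7 _≟_ X _ _ ((ss , (end , noSelfMatch) , refl) , _) lz =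
  let walk       = selfAlignment⇒sortedWalk X _≟_ 0 0 ss noSelfMatch end
      m , f , m≤ = proj₁ (walk⇒factorizable X walk)
  in  ≤-trans (lz-optimal X lz f z≤n) m≤
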